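{- The functor $G$ from the category $S5^{\to}_{\Box\Diamond}$ to $\mathit{Gen}$ is faithful.
   Context: A modality is a finite (possibly empty) word over $\{\Box, \Diamond\}$. For a modality $A$ and $M \in \{\Box, \Diamond\}$, $MA$ denotes the word obtained by prefixing $M$. The category $S5^{\to}_{\Box\Diamond}$ has the modalities as objects. Its primitive arrow terms are, for every modality $A$: - $\mathbf{1}_A : A \vdash A$; - $\varepsilon^\Box_A : \Box A \vdash A$; - $\delta^{\Diamond\Diamond}_A : \Diamond\Diamond A \vdash \Diamond A$; - $\delta^{\Diamond\Box}_A : \Diamond\Box A \vdash \Box A$. Below, $\delta^{\Diamond M}$ denotes either of the last two. Arrow terms are closed under composition and, for $M \in \{\Box, \Diamond\}$, under $f : A \vdash B \mapsto Mf : MA \vdash MB$. Arrows are equivalence classes of arrow terms modulo the smallest equivalence relation that relates only terms of the same type, is a congruence for these operations, and contains all instances of the following equations (for $f : A \vdash B$ and $M \in \{\Box, \Diamond\}$): - the categorial equations $f \circ \mathbf{1}_A = \mathbf{1}_B \circ f = f$ and $h \circ (g \circ f) = (h \circ g) \circ f$; - the functorial equations $M\mathbf{1}_A = \mathbf{1}_{MA}$ and $M(g \circ f) = Mg \circ Mf$; - $\varepsilon^\Box_B \circ \Box f = f \circ \varepsilon^\Box_A$; - $\delta^{\Diamond M}_B \circ \Diamond Mf = Mf \circ \delta^{\Diamond M}_A$; - $\delta^{\Diamond M}_A \circ \Diamond\delta^{\Diamond M}_A = \delta^{\Diamond M}_A \circ \delta^{\Diamond\Diamond}_{MA}$. $\mathit{Gen}$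 is the category whose objects are the finite ordinals. An arrow $n \to m$ of $\mathit{Gen}$ is an equivalence relation on the disjoint union of $n$ (source) and $m$ (target). Write $i_s$ and $j_t$ for the copies of $i \in n$ and $j \in m$. The identity on $n$ has classes $\{i_s, i_t\}$ for $i < n$. The composite of $R_1 : n \to m$ and $R_2 : m \to k$ is obtained by taking the equivalence relation on $n \sqcup m \sqcup k$ generated by $R_1 \cup R_2$ and restricting it to $n \sqcup k$. The functor $G$ sends a modality to its length. Occurrences in a modality of length $n$ are numbered $n-1, \dots, 0$ from left to right. For $A$ of length $n$: - $G\mathbf{1}_A$ is the identity; - $G\varepsilon^\Box_A$ has classes $\{i_s, i_t\}$ for $i < n$ and the singleton $\{n_s\}$; - $G\delta^{\Diamond M}_A$ (source of length $n+2$, target of length $n+1$) has classes $\{i_s, i_t\}$ for $i < n$ and $\{n_s, (n+1)_s, n_t\}$; - $G(g \circ f) = Gg \circ Gf$; - for $f : A \vdash B$ with lengths $n$ and $m$, the partition of $GMf$ is that of $Gf$ with the class $\{n_s, m_t\}$ added. -}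

module Defs where

open import Data.Nat using (ℕ; zero; suc; _⊓_)
open import Data.Fin using (Fin; toℕ; inject₁)
open import Data.Product using (_×_)
open import Data.Sum using (_⊎_; inj₁; inj₂; [_,_])
open import Data.List using (List; []; _∷_; length)
open import Relation.Binary.PropositionalEquality using (_≡_)
open import Relation.Binary.Construct.Closure.Equivalence using (EqClosure)

-- Modalities: finite words over {□, ◇}; M ∷ A is the word MA.

data Mod : Set where
  □ ◇ : Mod

Modality : Set
Modality = List Mod

infixr 9 _∘_

data _⊢_ : Modality → Modality → Set where
  𝟏   : (A : Modality) → A ⊢ A
  ε□  : (A : Modality) → (□ ∷ A) ⊢ A
  -- δ M A is δ^{◇M}_A : ◇MA ⊢ MA (M = ◇ gives δ^{◇◇}, M = □ gives δ^{◇□})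
  δ   : (M : Mod) (A : Modality) → (◇ ∷ M ∷ A) ⊢ (M ∷ A)
  _∘_ : ∀ {A B C} → B ⊢ C → A ⊢ B → A ⊢ C
  pre : ∀ {A B} (M : Mod) → A ⊢ B → (M ∷ A) ⊢ (M ∷ B)

infix 4 _≈_

data _≈_ : ∀ {A B} → A ⊢ B → A ⊢ B → Set where
  ≈-refl  : ∀ {A B} {f : A ⊢ B} → f ≈ f
  ≈-sym   : ∀ {A B} {f g : A ⊢ B} → f ≈ g → g ≈ f
  ≈-trans : ∀ {A B} {f g h : A ⊢ B} → f ≈ g → g ≈ h → f ≈ h
  ∘-cong  : ∀ {A B C} {f f′ : A ⊢ B} {g g′ : B ⊢ C} →
            g ≈ g′ → f ≈ f′ → g ∘ f ≈ g′ ∘ f′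
  pre-cong : ∀ {A B} (M : Mod) {f f′ : A ⊢ B} → f ≈ f′ → pre M f ≈ pre M f′
  idʳ     : ∀ {A B} (f : A ⊢ B) → f ∘ 𝟏 A ≈ f
  idˡ     : ∀ {A B} (f : A ⊢ B) → 𝟏 B ∘ f ≈ f
  assoc   : ∀ {A B C D} (h : C ⊢ D) (g : B ⊢ C) (f : A ⊢ B) →
            h ∘ (g ∘ f) ≈ (h ∘ g) ∘ f
  pre-id  : ∀ (M : Mod) (A : Modality) → pre M (𝟏 A) ≈ 𝟏 (M ∷ A)
  pre-∘   : ∀ {A B C} (M : Mod) (g : B ⊢ C) (f : A ⊢ B) →
            pre M (g ∘ f) ≈ pre M g ∘ pre M f
  ε□-nat  : ∀ {A B} (f : A ⊢ B) → ε□ B ∘ pre □ f ≈ f ∘ ε□ A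
  δ-nat   : ∀ {A B} (M : Mod) (f : A ⊢ B) →
            δ M B ∘ pre ◇ (pre M f) ≈ pre M f ∘ δ M A
  δ-assoc : ∀ (M : Mod) (A : Modality) →
            δ M A ∘ pre ◇ (δ M A) ≈ δ M A ∘ δ ◇ (M ∷ A)

-- The category Gen: an arrow n → m is an equivalence relation on the
-- disjoint union Fin n ⊎ Fin m (inj₁ i = i_s, inj₂ j = j_t).
-- Two arrows are equal iff they relate the same pairs.

GenRel : ℕ → ℕ → Set₁
GenRel n m = (Fin n ⊎ Fin m) → (Fin n ⊎ Fin m) → Set

_≐_ : ∀ {n m} → GenRel n m → GenRel n m → Set
R ≐ S = ∀ x y → (R x y → S x y) × (S x y → R x y)

lvl : ∀ {n m} → Fin n ⊎ Fin m → ℕ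
lvl = [ toℕ , toℕ ]

idG : ∀ n → GenRel n n
idG n x y = lvl x ≡ lvl y

εG : ∀ n → GenRel (suc n) n
εG n x y = lvl x ≡ lvl y

-- G δ^{◇M}_A for A of length n: classes {i_s,i_t} (i<n) and {n_s,(n+1)_s,n_t}
δlvl : ∀ n → Fin (suc (suc n)) ⊎ Fin (suc n) → ℕ
δlvl n = [ (λ i → toℕ i ⊓ n) , toℕ ]

δG : ∀ n → GenRel (suc (suc n)) (suc n)
δG n x y = δlvl n x ≡ δlvl n y

module _ {n m k : ℕ} (R₁ : GenRel n m) (R₂ : GenRel m k) where
  emb₁ : Fin n ⊎ Fin m → Fin n ⊎ (Fin m ⊎ Fin k)
  emb₁ (inj₁ i) = inj₁ i
  emb₁ (inj₂ j) = inj₂ (inj₁ j)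

  emb₂ : Fin m ⊎ Fin k → Fin n ⊎ (Fin m ⊎ Fin k)
  emb₂ (inj₁ j) = inj₂ (inj₁ j)
  emb₂ (inj₂ l) = inj₂ (inj₂ l)

  embO : Fin n ⊎ Fin k → Fin n ⊎ (Fin m ⊎ Fin k)
  embO (inj₁ i) = inj₁ i
  embO (inj₂ l) = inj₂ (inj₂ l)

  data Union : Fin n ⊎ (Fin m ⊎ Fin k) → Fin n ⊎ (Fin m ⊎ Fin k) → Set where
    left  : ∀ {x y} → R₁ x y → Union (emb₁ x) (emb₁ y)
    right : ∀ {x y} → R₂ x y → Union (emb₂ x) (emb₂ y)

  compG : GenRel n k
  compG x y = EqClosure Union (embO x) (embO y)

_∘G_ : ∀ {n m k} → GenRel m k → GenRel n m → GenRel n k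
R₂ ∘G R₁ = compG R₁ R₂

liftI : ∀ {n m} → Fin n ⊎ Fin m → Fin (suc n) ⊎ Fin (suc m)
liftI (inj₁ i) = inj₁ (inject₁ i)
liftI (inj₂ j) = inj₂ (inject₁ j)

isTop : ∀ {n m} → Fin (suc n) ⊎ Fin (suc m) → Set
isTop {n} {m} (inj₁ i) = toℕ i ≡ n
isTop {n} {m} (inj₂ j) = toℕ j ≡ m

data preG {n m : ℕ} (R : GenRel n m) : GenRel (suc n) (suc m) where
  old : ∀ {x y} → R x y → preG R (liftI x) (liftI y)
  new : ∀ {x y} → isTop {n} {m} x → isTop {n} {m} y → preG R x y

G : ∀ {A B} → A ⊢ B → GenRel (length A) (length B)
G (𝟏 A)     = idG (length A)
G (ε□ A)    = εG (length A)
G (δ M A)   = δG (length A)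
G (g ∘ f)   = G g ∘G G f
G (pre M f) = preG (G f)

-- G f is a partition of the occurrences in which every class contains at most
-- one target occurrence, so it is described by labelling each source occurrence
-- with its target occurrence or with a tag naming its targetless class. Along the
-- equations of S5→□◇ the labellings of the two sides differ only by a renaming
-- of tags, so G is well defined on arrows. Every arrow term equals a normal form,
-- built from the top occurrence down by keeping it, erasing it with ε□, merging it
-- by δ into the occurrence below, or merging and then erasing. The canonical
-- labelling of a normal form, which names a targetless class by its topmost
-- occurrence, is determined by its kernel and in turn determines the normal form,
-- so G f ≐ G g forces f and g to have the same normal form.

module Submission where

open import Defs
open import Data.Nat using (ℕ; suc; _⊓_; _<_; _≤_; s≤s; _≟_)
open import Data.Nat.Properties
open import Data.Fin using (Fin; toℕ; fromℕ<; lower₁)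
open import Data.Fin.Properties using (toℕ-fromℕ<; toℕ-inject₁; inject₁-lower₁; toℕ<n)
open import Data.Product using (∃; _×_; _,_; proj₁; proj₂)
open import Data.Sum using (_⊎_; inj₁; inj₂; map₂)
open import Data.Sum.Properties using (inj₁-injective; inj₂-injective)
open import Data.List using ([]; _∷_; length)
open import Data.Empty using (⊥-elim)
open import Function.Base using (_∘′_)
open import Relation.Nullary using (¬_; yes; no)
open import Relation.Binary.PropositionalEquality
import Relation.Binary.Construct.Closure.Equivalence as EqClosure
open import Relation.Binary.Construct.Closure.ReflexiveTransitive using (_◅◅_)

-- Labellings and the Gen arrows they induce

data Tag : Set where
  leaf          : ℕ → Tag
  earlier later : Tag → Tag

earlier-injective : ∀ {s t} → earlier s ≡ earlier t → s ≡ t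
earlier-injective refl = refl

Label : Set
Label = ℕ ⊎ Tag

inj₁≢inj₂ : ∀ {j : ℕ} {t : Tag} → inj₁ j ≢ inj₂ t
inj₁≢inj₂ ()

-- A labelling φ describes the Gen arrow n → m in which source i lies in the
-- class of target j when φ i = inj₁ j, and the sources carrying the same tag
-- form a class without target occurrences.
Labelling : Set
Labelling = ℕ → Label

label : ∀ {n m} → Labelling → Fin n ⊎ Fin m → Label
label φ (inj₁ i) = φ (toℕ i)
label φ (inj₂ j) = inj₁ (toℕ j)

Ker : ∀ n m → Labelling → GenRel n m
Ker n m φ x y = label φ x ≡ label φ y

Bounded : ℕ → ℕ → Labelling → Set
Bounded n m φ = ∀ i j → i < n → φ i ≡ inj₁ j → j < m

infix 4 _≗[_]_

_≗[_]_ : Labelling → ℕ → Labelling → Set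
φ ≗[ n ] ψ = ∀ i → i < n → φ i ≡ ψ i

rename : (Tag → Tag) → Labelling → Labelling
rename e φ i = map₂ e (φ i)

≐-refl : ∀ {n m} {R : GenRel n m} → R ≐ R
≐-refl x y = (λ r → r) , (λ r → r)

≐-sym : ∀ {n m} {R S : GenRel n m} → R ≐ S → S ≐ R
≐-sym R≐S x y = proj₂ (R≐S x y) , proj₁ (R≐S x y)

≐-trans : ∀ {n m} {R S T : GenRel n m} → R ≐ S → S ≐ T → R ≐ T
≐-trans R≐S S≐T x y = (λ r → proj₁ (S≐T x y) (proj₁ (R≐S x y) r))
                    , (λ t → proj₂ (R≐S x y) (proj₂ (S≐T x y) t))

label-cong : ∀ {n m} {φ ψ : Labelling} → φ ≗[ n ] ψ → (x : Fin n ⊎ Fin m) → label φ x ≡ label ψ x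
label-cong φ≗ψ (inj₁ i) = φ≗ψ (toℕ i) (toℕ<n i)
label-cong φ≗ψ (inj₂ j) = refl

Ker-cong : ∀ {n m} {φ ψ : Labelling} → φ ≗[ n ] ψ → Ker n m φ ≐ Ker n m ψ
Ker-cong φ≗ψ x y = (λ r → trans (sym (label-cong φ≗ψ x)) (trans r (label-cong φ≗ψ y)))
                 , (λ r → trans (label-cong φ≗ψ x) (trans r (sym (label-cong φ≗ψ y))))

Ker-rename : ∀ {n m} {φ ψ : Labelling} (e e⁻ : Tag → Tag) → (∀ t → e⁻ (e t) ≡ t) →
             ψ ≗[ n ] rename e φ → Ker n m φ ≐ Ker n m ψ
Ker-rename {n} {m} {φ} e e⁻ e⁻∘e ψ≗eφ = ≐-trans renamed (≐-sym (Ker-cong ψ≗eφ))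
  where
  label-rename : (x : Fin n ⊎ Fin m) → label (rename e φ) x ≡ map₂ e (label φ x)
  label-rename (inj₁ i) = refl
  label-rename (inj₂ j) = refl

  map₂-cancel : ∀ {u v : Label} → map₂ e u ≡ map₂ e v → u ≡ v
  map₂-cancel {inj₁ _} {inj₁ _} refl = refl
  map₂-cancel {inj₂ s} {inj₂ t} eq =
    cong inj₂ (trans (sym (e⁻∘e s)) (trans (cong e⁻ (inj₂-injective eq)) (e⁻∘e t)))

  renamed : Ker n m φ ≐ Ker n m (rename e φ)
  renamed x y =
    (λ r → trans (label-rename x) (trans (cong (map₂ e) r) (sym (label-rename y))))
    , (λ r → map₂-cancel (trans (sym (label-rename x)) (trans r (label-rename y))))

update : ℕ → Label → Labelling → Labelling
update a v φ i with i ≟ a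
... | yes _ = v
... | no _  = φ i

update-≡ : ∀ a v φ → update a v φ a ≡ v
update-≡ a v φ with a ≟ a
... | yes _  = refl
... | no a≢a = ⊥-elim (a≢a refl)

update-< : ∀ {a i} v φ → i < a → update a v φ i ≡ φ i
update-< {a} {i} v φ i<a with i ≟ a
... | yes i≡a = ⊥-elim (<⇒≢ i<a i≡a)
... | no _    = refl

update-≗ : ∀ a v φ → update a v φ ≗[ a ] φ
update-≗ a v φ i = update-< v φ

≗-step : ∀ {n φ ψ} → φ ≗[ n ] ψ → φ n ≡ ψ n → φ ≗[ suc n ] ψ
≗-step φ≗ψ top i i<1+n with m<1+n⇒m<n∨m≡n i<1+n
... | inj₁ i<n  = φ≗ψ i i<n
... | inj₂ refl = top

extend : ℕ → ℕ → Labelling → Labelling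
extend n m = update n (inj₁ m)

extend-≗ : ∀ n m φ → extend n m φ ≗[ n ] φ
extend-≗ n m = update-≗ n (inj₁ m)

update-cases : ∀ {a i v φ w} → i < suc a → update a v φ i ≡ w → (i ≡ a × v ≡ w) ⊎ (i < a × φ i ≡ w)
update-cases {a} {i} {v} {φ} i<1+a eq with m<1+n⇒m<n∨m≡n i<1+a
... | inj₁ i<a  = inj₂ (i<a , trans (sym (update-< v φ i<a)) eq)
... | inj₂ refl = inj₁ (refl , trans (sym (update-≡ a v φ)) eq)

update-top : ∀ {a v w φ ψ} → update a v φ ≗[ suc a ] update a w ψ → v ≡ w
update-top {a} {v} {w} {φ} {ψ} eq = trans (sym (update-≡ a v φ)) (trans (eq a ≤-refl) (update-≡ a w ψ))

update-below : ∀ {a v w φ ψ} → update a v φ ≗[ suc a ] update a w ψ → φ ≗[ a ] ψ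
update-below {v = v} {w} {φ} {ψ} eq i i<a =
  trans (sym (update-< v φ i<a)) (trans (eq i (m<n⇒m<1+n i<a)) (update-< w ψ i<a))

Bounded-update : ∀ {a b v φ} → Bounded a b φ → (∀ j → v ≡ inj₁ j → j < b) → Bounded (suc a) b (update a v φ)
Bounded-update bφ bv i j i<1+a eq with update-cases i<1+a eq
... | inj₁ (_ , v≡j)  = bv j v≡j
... | inj₂ (i<a , φi) = bφ i j i<a φi

Bounded-extend : ∀ {n m φ} → Bounded n m φ → Bounded (suc n) (suc m) (extend n m φ)
Bounded-extend bφ = Bounded-update (λ i j i<n φi → m<n⇒m<1+n (bφ i j i<n φi))
                                   (λ j eq → ≤-reflexive (cong suc (sym (inj₁-injective eq))))

push : Labelling → Label → Label
push ψ (inj₁ j) = map₂ later (ψ j)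
push ψ (inj₂ t) = inj₂ (earlier t)

infixr 9 _⊙_

_⊙_ : Labelling → Labelling → Labelling
(ψ ⊙ φ) i = push ψ (φ i)

Bounded-⊙ : ∀ {n m k φ ψ} → Bounded n m φ → Bounded m k ψ → Bounded n k (ψ ⊙ φ)
Bounded-⊙ {φ = φ} {ψ} bφ bψ i l i<n eq with φ i in φi
... | inj₁ j with ψ j in ψj
...   | inj₁ _ = bψ j l (bφ i j i<n φi) (trans ψj (cong inj₁ (inj₁-injective eq)))

module _ {n m k : ℕ} (φ ψ : Labelling) where

  private
    R₁ = Ker n m φ
    R₂ = Ker m k ψ
    Path = EqClosure.EqClosure (Union R₁ R₂)

  joint : Fin n ⊎ (Fin m ⊎ Fin k) → Label
  joint (inj₁ i)        = push ψ (φ (toℕ i))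
  joint (inj₂ (inj₁ j)) = map₂ later (ψ (toℕ j))
  joint (inj₂ (inj₂ l)) = inj₁ (toℕ l)

  joint-step : ∀ {a b} → Union R₁ R₂ a b → joint a ≡ joint b
  joint-step (left  {inj₁ _} {inj₁ _} r) = cong (push ψ) r
  joint-step (left  {inj₁ _} {inj₂ _} r) = cong (push ψ) r
  joint-step (left  {inj₂ _} {inj₁ _} r) = cong (push ψ) r
  joint-step (left  {inj₂ _} {inj₂ _} r) = cong (push ψ) r
  joint-step (right {inj₁ _} {inj₁ _} r) = cong (map₂ later) r
  joint-step (right {inj₁ _} {inj₂ _} r) = cong (map₂ later) r
  joint-step (right {inj₂ _} {inj₁ _} r) = cong (map₂ later) r
  joint-step (right {inj₂ _} {inj₂ _} r) = cong (map₂ later) r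

  ∘G⇒Ker⊙ : ∀ x y → (R₂ ∘G R₁) x y → Ker n k (ψ ⊙ φ) x y
  ∘G⇒Ker⊙ (inj₁ _) (inj₁ _) = EqClosure.gfold isEquivalence joint joint-step
  ∘G⇒Ker⊙ (inj₁ _) (inj₂ _) = EqClosure.gfold isEquivalence joint joint-step
  ∘G⇒Ker⊙ (inj₂ _) (inj₁ _) = EqClosure.gfold isEquivalence joint joint-step
  ∘G⇒Ker⊙ (inj₂ _) (inj₂ _) = EqClosure.gfold isEquivalence joint joint-step

  private
    later≢earlier : ∀ (u : Label) {t} → map₂ later u ≢ inj₂ (earlier t)
    later≢earlier (inj₁ _) ()
    later≢earlier (inj₂ _) ()

    map₂-later-injective : ∀ {u v : Label} → map₂ later u ≡ map₂ later v → u ≡ v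
    map₂-later-injective {inj₁ _} {inj₁ _} refl = refl
    map₂-later-injective {inj₂ _} {inj₂ _} refl = refl

  data Reach (x : Fin n ⊎ Fin k) : Set where
    unreached : ∀ {i t} → x ≡ inj₁ i → φ (toℕ i) ≡ inj₂ t →
                label (ψ ⊙ φ) x ≡ inj₂ (earlier t) → Reach x
    reached   : ∀ z → Path (embO R₁ R₂ x) (emb₂ R₁ R₂ z) →
                label (ψ ⊙ φ) x ≡ map₂ later (label ψ z) → Reach x

  reach : Bounded n m φ → ∀ x → Reach x
  reach bφ (inj₂ l) = reached (inj₂ l) (EqClosure.reflexive _) refl
  reach bφ (inj₁ i) with φ (toℕ i) in φi
  ... | inj₂ t = unreached refl φi (cong (push ψ) φi)
  ... | inj₁ j = reached (inj₁ (fromℕ< j<m)) (EqClosure.return (left toMiddle))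
                         (cong (push ψ) (trans φi (sym middle)))
    where
    j<m = bφ (toℕ i) j (toℕ<n i) φi
    middle : inj₁ (toℕ (fromℕ< j<m)) ≡ inj₁ j
    middle = cong inj₁ (toℕ-fromℕ< j<m)
    toMiddle : R₁ (inj₁ i) (inj₂ (fromℕ< j<m))
    toMiddle = trans φi (sym middle)

  Ker⊙⇒∘G : Bounded n m φ → ∀ x y → Ker n k (ψ ⊙ φ) x y → (R₂ ∘G R₁) x y
  Ker⊙⇒∘G bφ x y r with reach bφ x | reach bφ y
  ... | unreached refl φi lx | unreached refl φi′ ly =
    EqClosure.return (left (trans φi (trans (cong inj₂ t≡t′) (sym φi′))))
    where t≡t′ = earlier-injective (inj₂-injective (trans (sym lx) (trans r ly)))
  ... | unreached _ _ lx | reached z _ ly = ⊥-elim (later≢earlier (label ψ z) (trans (sym ly) (trans (sym r) lx)))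
  ... | reached z _ lx | unreached _ _ ly = ⊥-elim (later≢earlier (label ψ z) (trans (sym lx) (trans r ly)))
  ... | reached z px lx | reached z′ py ly =
    px ◅◅ (EqClosure.return (right (map₂-later-injective (trans (sym lx) (trans r ly))))
       ◅◅ EqClosure.symmetric _ py)

  Ker-∘G : Bounded n m φ → (Ker m k ψ ∘G Ker n m φ) ≐ Ker n k (ψ ⊙ φ)
  Ker-∘G bφ x y = ∘G⇒Ker⊙ x y , Ker⊙⇒∘G bφ x y

∘G-cong : ∀ {n m k} {R R′ : GenRel n m} {S S′ : GenRel m k} →
          R ≐ R′ → S ≐ S′ → (S ∘G R) ≐ (S′ ∘G R′)
∘G-cong R≐R′ S≐S′ x y = EqClosure.map (union R≐R′ S≐S′) , EqClosure.map (union (≐-sym R≐R′) (≐-sym S≐S′))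
  where
  union : ∀ {R R′ S S′} → R ≐ R′ → S ≐ S′ → ∀ {a b} → Union R S a b → Union R′ S′ a b
  union R≐R′ S≐S′ (left  {x} {y} r) = left  (proj₁ (R≐R′ x y) r)
  union R≐R′ S≐S′ (right {x} {y} s) = right (proj₁ (S≐S′ x y) s)

preG-cong : ∀ {n m} {R S : GenRel n m} → R ≐ S → preG R ≐ preG S
preG-cong R≐S x y = preG-map R≐S x y , preG-map (≐-sym R≐S) x y
  where
  preG-map : ∀ {R S} → R ≐ S → ∀ x y → preG R x y → preG S x y
  preG-map R≐S _ _ (old {x} {y} r) = old (proj₁ (R≐S x y) r)
  preG-map R≐S _ _ (new top₁ top₂) = new top₁ top₂

module _ {n m : ℕ} (φ : Labelling) (bφ : Bounded n m φ) where

  private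
    φ⁺ = extend n m φ

  data Lifted : Fin (suc n) ⊎ Fin (suc m) → Set where
    topmost : ∀ {x} → isTop {n} {m} x → Lifted x
    lift    : ∀ x → Lifted (liftI x)

  lifted : ∀ x → Lifted x
  lifted (inj₁ i) with toℕ i ≟ n
  ... | yes i≡n = topmost i≡n
  ... | no i≢n  = subst Lifted (cong inj₁ (inject₁-lower₁ i (i≢n ∘′ sym))) (lift (inj₁ (lower₁ i (i≢n ∘′ sym))))
  lifted (inj₂ j) with toℕ j ≟ m
  ... | yes j≡m = topmost j≡m
  ... | no j≢m  = subst Lifted (cong inj₂ (inject₁-lower₁ j (j≢m ∘′ sym))) (lift (inj₂ (lower₁ j (j≢m ∘′ sym))))

  label-lift : (x : Fin n ⊎ Fin m) → label φ⁺ (liftI x) ≡ label φ x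
  label-lift (inj₁ i) rewrite toℕ-inject₁ i = update-< _ φ (toℕ<n i)
  label-lift (inj₂ j) = cong inj₁ (toℕ-inject₁ j)

  label-top : (x : Fin (suc n) ⊎ Fin (suc m)) → isTop {n} {m} x → label φ⁺ x ≡ inj₁ m
  label-top (inj₁ i) i≡n = trans (cong φ⁺ i≡n) (update-≡ n _ φ)
  label-top (inj₂ j) j≡m = cong inj₁ j≡m

  label-below : (x : Fin n ⊎ Fin m) → label φ x ≢ inj₁ m
  label-below (inj₁ i) eq = <-irrefl refl (bφ (toℕ i) m (toℕ<n i) eq)
  label-below (inj₂ j) eq = <-irrefl (inj₁-injective eq) (toℕ<n j)

  Ker-preG : preG (Ker n m φ) ≐ Ker (suc n) (suc m) φ⁺
  Ker-preG x y = preG⇒Ker x y , Ker⇒preG x y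
    where
    preG⇒Ker : ∀ x y → preG (Ker n m φ) x y → Ker (suc n) (suc m) φ⁺ x y
    preG⇒Ker _ _ (old {x} {y} r)  = trans (label-lift x) (trans r (sym (label-lift y)))
    preG⇒Ker x y (new top₁ top₂) = trans (label-top x top₁) (sym (label-top y top₂))

    Ker⇒preG : ∀ x y → Ker (suc n) (suc m) φ⁺ x y → preG (Ker n m φ) x y
    Ker⇒preG x y r with lifted x | lifted y
    ... | topmost top₁ | topmost top₂ = new top₁ top₂
    ... | topmost top₁ | lift y       = ⊥-elim (label-below y (trans (sym (label-lift y)) (trans (sym r) (label-top x top₁))))
    ... | lift x       | topmost top₂ = ⊥-elim (label-below x (trans (sym (label-lift x)) (trans r (label-top y top₂))))
    ... | lift x       | lift y       = old (trans (sym (label-lift x)) (trans r (label-lift y)))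

-- Labellings of arrow terms

εL : ℕ → Labelling
εL n = update n (inj₂ (leaf 0)) inj₁

δL : ℕ → Labelling
δL n i = inj₁ (i ⊓ n)

⟦_⟧ : ∀ {A B} → A ⊢ B → Labelling
⟦ 𝟏 A ⟧             = inj₁
⟦ ε□ A ⟧            = εL (length A)
⟦ δ M A ⟧           = δL (length A)
⟦ g ∘ f ⟧           = ⟦ g ⟧ ⊙ ⟦ f ⟧
⟦ pre {A} {B} M f ⟧ = extend (length A) (length B) ⟦ f ⟧

Bounded-⟦⟧ : ∀ {A B} (f : A ⊢ B) → Bounded (length A) (length B) ⟦ f ⟧
Bounded-⟦⟧ (𝟏 A)     i j i<n eq   = subst (_< length A) (inj₁-injective eq) i<n
Bounded-⟦⟧ (ε□ A)    i j i<1+n eq with m<1+n⇒m<n∨m≡n i<1+n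
... | inj₁ i<n  = subst (_< length A) (inj₁-injective (trans (sym (update-< _ inj₁ i<n)) eq)) i<n
... | inj₂ refl with () ← trans (sym (update-≡ (length A) _ inj₁)) eq
Bounded-⟦⟧ (δ M A)   i j i<n eq   = subst (_< suc (length A)) (inj₁-injective eq) (s≤s (m⊓n≤n i (length A)))
Bounded-⟦⟧ (g ∘ f)   = Bounded-⊙ (Bounded-⟦⟧ f) (Bounded-⟦⟧ g)
Bounded-⟦⟧ (pre M f) = Bounded-extend (Bounded-⟦⟧ f)

kernel≐Ker : ∀ {n m} (φ : Labelling) (lv : Fin n ⊎ Fin m → ℕ) (h : ℕ → Label) →
             (∀ {a b} → h a ≡ h b → a ≡ b) → (∀ x → label φ x ≡ h (lv x)) →
             (λ x y → lv x ≡ lv y) ≐ Ker n m φ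
kernel≐Ker φ lv h h-injective label≡ x y =
  (λ r → trans (label≡ x) (trans (cong h r) (sym (label≡ y))))
  , (λ r → h-injective (trans (sym (label≡ x)) (trans r (label≡ y))))

G-𝟏 : ∀ A → G (𝟏 A) ≐ Ker (length A) (length A) ⟦ 𝟏 A ⟧
G-𝟏 A = kernel≐Ker inj₁ lvl inj₁ inj₁-injective λ { (inj₁ i) → refl ; (inj₂ j) → refl }

G-ε□ : ∀ A → G (ε□ A) ≐ Ker (suc (length A)) (length A) ⟦ ε□ A ⟧
G-ε□ A = kernel≐Ker (εL n) lvl (εL n) εL-injective
           λ { (inj₁ i) → refl ; (inj₂ j) → sym (update-< _ inj₁ (toℕ<n j)) }
  where
  n = length A
  εL-injective : ∀ {a b} → εL n a ≡ εL n b → a ≡ b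
  εL-injective {a} {b} eq with a ≟ n | b ≟ n
  ... | yes a≡n | yes b≡n = trans a≡n (sym b≡n)
  ... | no _    | no _    = inj₁-injective eq

G-δ : ∀ M A → G (δ M A) ≐ Ker (suc (suc (length A))) (suc (length A)) ⟦ δ M A ⟧
G-δ M A = kernel≐Ker (δL (length A)) (δlvl (length A)) inj₁ inj₁-injective
            λ { (inj₁ i) → refl ; (inj₂ j) → refl }

G≐Ker⟦⟧ : ∀ {A B} (f : A ⊢ B) → G f ≐ Ker (length A) (length B) ⟦ f ⟧
G≐Ker⟦⟧ (𝟏 A)     = G-𝟏 A
G≐Ker⟦⟧ (ε□ A)    = G-ε□ A
G≐Ker⟦⟧ (δ M A)   = G-δ M A
G≐Ker⟦⟧ (g ∘ f)   = ≐-trans (∘G-cong (G≐Ker⟦⟧ f) (G≐Ker⟦⟧ g)) (Ker-∘G ⟦ f ⟧ ⟦ g ⟧ (Bounded-⟦⟧ f))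
G≐Ker⟦⟧ (pre M f) = ≐-trans (preG-cong (G≐Ker⟦⟧ f)) (Ker-preG ⟦ f ⟧ (Bounded-⟦⟧ f))

push-congˡ : ∀ {m ψ ψ′} → ψ ≗[ m ] ψ′ → ∀ u → (∀ j → u ≡ inj₁ j → j < m) → push ψ u ≡ push ψ′ u
push-congˡ ψ≗ψ′ (inj₁ j) bound = cong (map₂ later) (ψ≗ψ′ j (bound j refl))
push-congˡ ψ≗ψ′ (inj₂ t) bound = refl

push-inj₁ : ∀ u → push inj₁ u ≡ map₂ earlier u
push-inj₁ (inj₁ _) = refl
push-inj₁ (inj₂ _) = refl

strip : Tag → Tag
strip (leaf d)    = leaf d
strip (earlier t) = t
strip (later t)   = t

swap : Tag → Tag
swap (leaf d)    = leaf d
swap (earlier t) = later t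
swap (later t)   = earlier t

swap-involutive : ∀ t → swap (swap t) ≡ t
swap-involutive (leaf _)    = refl
swap-involutive (earlier _) = refl
swap-involutive (later _)   = refl

map₂-swap-later : ∀ (u : Label) → map₂ swap (map₂ later u) ≡ map₂ earlier u
map₂-swap-later (inj₁ _) = refl
map₂-swap-later (inj₂ _) = refl

-- The bijection of tags that turns h ⊙ (g ⊙ φ) into (h ⊙ g) ⊙ φ.
reassoc : Tag → Tag
reassoc (leaf d)              = leaf d
reassoc (earlier (leaf d))    = later (leaf d)
reassoc (earlier (earlier t)) = earlier t
reassoc (earlier (later t))   = later (earlier t)
reassoc (later t)             = later (later t)

unreassoc : Tag → Tag
unreassoc (leaf d)            = leaf d
unreassoc (earlier t)         = earlier (earlier t)
unreassoc (later (leaf d))    = earlier (leaf d)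
unreassoc (later (earlier t)) = earlier (later t)
unreassoc (later (later t))   = later t

unreassoc-reassoc : ∀ t → unreassoc (reassoc t) ≡ t
unreassoc-reassoc (leaf _)              = refl
unreassoc-reassoc (earlier (leaf _))    = refl
unreassoc-reassoc (earlier (earlier _)) = refl
unreassoc-reassoc (earlier (later _))   = refl
unreassoc-reassoc (later _)             = refl

⊙-assoc : ∀ (h g φ : Labelling) i → ((h ⊙ g) ⊙ φ) i ≡ rename reassoc (h ⊙ (g ⊙ φ)) i
⊙-assoc h g φ i with φ i
... | inj₂ _ = refl
... | inj₁ j with g j
...   | inj₂ _ = refl
...   | inj₁ k with h k
...     | inj₁ _ = refl
...     | inj₂ _ = refl

extend-inj₁ : ∀ n → extend n n inj₁ ≗[ suc n ] inj₁
extend-inj₁ n = ≗-step (extend-≗ n n inj₁) (update-≡ n _ inj₁)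

extend-⊙ : ∀ {n m k φ} ψ → Bounded n m φ →
           extend n k (ψ ⊙ φ) ≗[ suc n ] extend m k ψ ⊙ extend n m φ
extend-⊙ {n} {m} {k} {φ} ψ bφ = ≗-step below top
  where
  below : extend n k (ψ ⊙ φ) ≗[ n ] extend m k ψ ⊙ extend n m φ
  below i i<n = begin
    extend n k (ψ ⊙ φ) i          ≡⟨ extend-≗ n k _ i i<n ⟩
    push ψ (φ i)                  ≡⟨ push-congˡ (λ j j<m → sym (extend-≗ m k ψ j j<m)) (φ i) (λ j → bφ i j i<n) ⟩
    push (extend m k ψ) (φ i)     ≡⟨ cong (push (extend m k ψ)) (sym (extend-≗ n m φ i i<n)) ⟩
    (extend m k ψ ⊙ extend n m φ) i ∎
    where open ≡-Reasoning
  top : extend n k (ψ ⊙ φ) n ≡ (extend m k ψ ⊙ extend n m φ) n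
  top rewrite update-≡ n (inj₁ k) (ψ ⊙ φ) | update-≡ n (inj₁ m) φ | update-≡ m (inj₁ k) ψ = refl

push-≗inj₁ : ∀ {m ψ} → ψ ≗[ m ] inj₁ → ∀ u → (∀ j → u ≡ inj₁ j → j < m) → push ψ u ≡ map₂ earlier u
push-≗inj₁ ψ≗inj₁ u bound = trans (push-congˡ ψ≗inj₁ u bound) (push-inj₁ u)

εL-natural : ∀ {n m φ} → Bounded n m φ → εL m ⊙ extend n m φ ≗[ suc n ] rename swap (φ ⊙ εL n)
εL-natural {n} {m} {φ} bφ = ≗-step below top
  where
  below : εL m ⊙ extend n m φ ≗[ n ] rename swap (φ ⊙ εL n)
  below i i<n = begin
    push (εL m) (extend n m φ i)     ≡⟨ cong (push (εL m)) (extend-≗ n m φ i i<n) ⟩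
    push (εL m) (φ i)                ≡⟨ push-≗inj₁ (update-≗ m _ inj₁) (φ i) (λ j → bφ i j i<n) ⟩
    map₂ earlier (φ i)               ≡⟨ map₂-swap-later (φ i) ⟨
    map₂ swap (push φ (inj₁ i))      ≡⟨ cong (map₂ swap ∘′ push φ) (update-< _ inj₁ i<n) ⟨
    map₂ swap (push φ (εL n i))      ∎
    where open ≡-Reasoning
  top : (εL m ⊙ extend n m φ) n ≡ rename swap (φ ⊙ εL n) n
  top rewrite update-≡ n (inj₁ m) φ | update-≡ m (inj₂ (leaf 0)) inj₁ | update-≡ n (inj₂ (leaf 0)) inj₁ = refl

suc-⊓ : ∀ n → suc n ⊓ n ≡ n
suc-⊓ n = m≥n⇒m⊓n≡n (n≤1+n n)

δL-≗ : ∀ m → δL m ≗[ suc m ] inj₁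
δL-≗ m j j<1+m = cong inj₁ (m≤n⇒m⊓n≡m (≤-pred j<1+m))

δL-natural : ∀ {n m φ} → Bounded n m φ →
             δL m ⊙ extend (suc n) (suc m) (extend n m φ) ≗[ suc (suc n) ] rename swap (extend n m φ ⊙ δL n)
δL-natural {n} {m} {φ} bφ = ≗-step below top
  where
  φ⁺ = extend n m φ
  below : δL m ⊙ extend (suc n) (suc m) φ⁺ ≗[ suc n ] rename swap (φ⁺ ⊙ δL n)
  below i i<1+n = begin
    push (δL m) (extend (suc n) (suc m) φ⁺ i) ≡⟨ cong (push (δL m)) (extend-≗ (suc n) (suc m) φ⁺ i i<1+n) ⟩
    push (δL m) (φ⁺ i)                        ≡⟨ push-≗inj₁ (δL-≗ m) (φ⁺ i) (λ j → Bounded-extend bφ i j i<1+n) ⟩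
    map₂ earlier (φ⁺ i)                       ≡⟨ map₂-swap-later (φ⁺ i) ⟨
    map₂ swap (map₂ later (φ⁺ i))
      ≡⟨ cong (λ k → map₂ swap (map₂ later (φ⁺ k))) (m≤n⇒m⊓n≡m (≤-pred i<1+n)) ⟨
    map₂ swap (map₂ later (φ⁺ (i ⊓ n)))       ∎
    where open ≡-Reasoning
  top : (δL m ⊙ extend (suc n) (suc m) φ⁺) (suc n) ≡ rename swap (φ⁺ ⊙ δL n) (suc n)
  top rewrite update-≡ (suc n) (inj₁ (suc m)) φ⁺ | suc-⊓ m | suc-⊓ n | update-≡ n (inj₁ m) φ = refl

δL-above : ∀ {n k} → n ≤ k → δL n k ≡ inj₁ n
δL-above n≤k = cong inj₁ (m≥n⇒m⊓n≡n n≤k)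

δL-absorb : ∀ {n k} → n ≤ k → ∀ i → (δL n ⊙ δL k) i ≡ δL n i
δL-absorb {n} {k} n≤k i = cong inj₁ (trans (⊓-assoc i k n) (cong (i ⊓_) (m≥n⇒m⊓n≡n n≤k)))

δL-assoc : ∀ n → δL n ⊙ extend (suc (suc n)) (suc n) (δL n) ≗[ suc (suc (suc n)) ] δL n ⊙ δL (suc n)
δL-assoc n i i<3+n = trans (merged i i<3+n) (sym (δL-absorb (n≤1+n n) i))
  where
  merged : δL n ⊙ extend (suc (suc n)) (suc n) (δL n) ≗[ suc (suc (suc n)) ] δL n
  merged = ≗-step (λ i i<2+n → trans (cong (push (δL n)) (extend-≗ _ _ (δL n) i i<2+n)) (δL-absorb ≤-refl i))
                  (trans (cong (push (δL n)) (update-≡ (suc (suc n)) _ (δL n)))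
                         (trans (δL-above (n≤1+n n)) (sym (δL-above (m≤n⇒m≤1+n (n≤1+n n))))))

⟦⟧-≐⇒G : ∀ {A B} (f g : A ⊢ B) →
         Ker (length A) (length B) ⟦ f ⟧ ≐ Ker (length A) (length B) ⟦ g ⟧ → G f ≐ G g
⟦⟧-≐⇒G f g ⟦f⟧≐⟦g⟧ = ≐-trans (G≐Ker⟦⟧ f) (≐-trans ⟦f⟧≐⟦g⟧ (≐-sym (G≐Ker⟦⟧ g)))

G-resp-≈ : ∀ {A B} {f g : A ⊢ B} → f ≈ g → G f ≐ G g
G-resp-≈ ≈-refl            = ≐-refl
G-resp-≈ (≈-sym f≈g)       = ≐-sym (G-resp-≈ f≈g)
G-resp-≈ (≈-trans f≈g g≈h) = ≐-trans (G-resp-≈ f≈g) (G-resp-≈ g≈h)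
G-resp-≈ (∘-cong g≈g′ f≈f′) = ∘G-cong (G-resp-≈ f≈f′) (G-resp-≈ g≈g′)
G-resp-≈ (pre-cong M f≈f′)  = preG-cong (G-resp-≈ f≈f′)
G-resp-≈ (idʳ {A} f) = ⟦⟧-≐⇒G (f ∘ 𝟏 A) f
  (≐-sym (Ker-rename later strip (λ _ → refl) (λ _ _ → refl)))
G-resp-≈ (idˡ {B = B} f) = ⟦⟧-≐⇒G (𝟏 B ∘ f) f
  (≐-sym (Ker-rename earlier strip (λ _ → refl) (λ i _ → push-inj₁ (⟦ f ⟧ i))))
G-resp-≈ (assoc h g f) = ⟦⟧-≐⇒G (h ∘ (g ∘ f)) ((h ∘ g) ∘ f)
  (Ker-rename reassoc unreassoc unreassoc-reassoc (λ i _ → ⊙-assoc ⟦ h ⟧ ⟦ g ⟧ ⟦ f ⟧ i))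
G-resp-≈ (pre-id M A) = ⟦⟧-≐⇒G (pre M (𝟏 A)) (𝟏 (M ∷ A)) (Ker-cong (extend-inj₁ (length A)))
G-resp-≈ (pre-∘ M g f) = ⟦⟧-≐⇒G (pre M (g ∘ f)) (pre M g ∘ pre M f) (Ker-cong (extend-⊙ ⟦ g ⟧ (Bounded-⟦⟧ f)))
G-resp-≈ (ε□-nat {A} {B} f) = ⟦⟧-≐⇒G (ε□ B ∘ pre □ f) (f ∘ ε□ A)
  (≐-sym (Ker-rename swap swap swap-involutive (εL-natural (Bounded-⟦⟧ f))))
G-resp-≈ (δ-nat {A} {B} M f) = ⟦⟧-≐⇒G (δ M B ∘ pre ◇ (pre M f)) (pre M f ∘ δ M A)
  (≐-sym (Ker-rename swap swap swap-involutive (δL-natural (Bounded-⟦⟧ f))))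
G-resp-≈ (δ-assoc M A) = ⟦⟧-≐⇒G (δ M A ∘ pre ◇ (δ M A)) (δ M A ∘ δ ◇ (M ∷ A)) (Ker-cong (δL-assoc (length A)))

-- Normal forms

infixr 5 _▸_

_▸_ : ∀ {A B} {f g h : A ⊢ B} → f ≈ g → g ≈ h → f ≈ h
_▸_ = ≈-trans

∘-congˡ : ∀ {A B C} {g : B ⊢ C} {f f′ : A ⊢ B} → f ≈ f′ → g ∘ f ≈ g ∘ f′
∘-congˡ = ∘-cong ≈-refl

∘-congʳ : ∀ {A B C} {g g′ : B ⊢ C} {f : A ⊢ B} → g ≈ g′ → g ∘ f ≈ g′ ∘ f
∘-congʳ g≈g′ = ∘-cong g≈g′ ≈-refl

assoc⁻ : ∀ {A B C D} (h : C ⊢ D) (g : B ⊢ C) (f : A ⊢ B) → (h ∘ g) ∘ f ≈ h ∘ (g ∘ f)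
assoc⁻ h g f = ≈-sym (assoc h g f)

merge : ∀ {A B} (M : Mod) → A ⊢ (M ∷ B) → (◇ ∷ A) ⊢ (M ∷ B)
merge {B = B} M f = δ M B ∘ pre ◇ f

merge-cong : ∀ {A B} (M : Mod) {f f′ : A ⊢ (M ∷ B)} → f ≈ f′ → merge M f ≈ merge M f′
merge-cong M f≈f′ = ∘-congˡ (pre-cong ◇ f≈f′)

merge-∘ : ∀ {A B C} (M : Mod) (g : B ⊢ (M ∷ C)) (f : A ⊢ B) → merge M (g ∘ f) ≈ merge M g ∘ pre ◇ f
merge-∘ {C = C} M g f = ∘-congˡ (pre-∘ ◇ g f) ▸ assoc (δ M C) (pre ◇ g) (pre ◇ f)

merge-pre : ∀ {A B C} (M : Mod) (g : B ⊢ C) (f : A ⊢ (M ∷ B)) → merge M (pre M g ∘ f) ≈ pre M g ∘ merge M f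
merge-pre {B = B} M g f =
  merge-∘ M (pre M g) f ▸ ∘-congʳ (δ-nat M g) ▸ assoc⁻ (pre M g) (δ M B) (pre ◇ f)

merge-merge : ∀ {A B C} (M : Mod) (g : B ⊢ (M ∷ C)) (f : A ⊢ (◇ ∷ B)) →
              merge M (merge M g ∘ f) ≈ merge M g ∘ merge ◇ f
merge-merge {C = C} M g f =
  merge-cong M (assoc⁻ (δ M C) (pre ◇ g) f)
  ▸ merge-∘ M (δ M C) (pre ◇ g ∘ f)
  ▸ ∘-congʳ (δ-assoc M C)
  ▸ assoc⁻ (δ M C) (δ ◇ (M ∷ C)) (pre ◇ (pre ◇ g ∘ f))
  ▸ ∘-congˡ (merge-pre ◇ g f)
  ▸ assoc (δ M C) (pre ◇ g) (merge ◇ f)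

ε□-merge-pre : ∀ {A B C} (g : B ⊢ C) (f : A ⊢ (□ ∷ B)) →
               ε□ C ∘ merge □ (pre □ g ∘ f) ≈ (g ∘ ε□ B) ∘ merge □ f
ε□-merge-pre {C = C} g f =
  ∘-congˡ (merge-pre □ g f) ▸ assoc (ε□ C) (pre □ g) (merge □ f) ▸ ∘-congʳ (ε□-nat g)

data NF : Modality → Modality → Set where
  nil       : NF [] []
  keep      : ∀ {A B} (M : Mod) → NF A B → NF (M ∷ A) (M ∷ B)
  erase     : ∀ {A B} → NF A B → NF (□ ∷ A) B
  join      : ∀ {A B} (M : Mod) → NF A (M ∷ B) → NF (◇ ∷ A) (M ∷ B)
  joinErase : ∀ {A B} → NF A (□ ∷ B) → NF (◇ ∷ A) B

⌜_⌝ : ∀ {A B} → NF A B → A ⊢ B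
⌜ nil ⌝                 = 𝟏 []
⌜ keep M n ⌝            = pre M ⌜ n ⌝
⌜ erase {A} n ⌝         = ⌜ n ⌝ ∘ ε□ A
⌜ join M n ⌝            = merge M ⌜ n ⌝
⌜ joinErase {B = B} n ⌝ = ε□ B ∘ merge □ ⌜ n ⌝

infixr 9 _∘ₙ_

_∘ₙ_ : ∀ {A B C} → NF B C → NF A B → NF A C
g           ∘ₙ nil          = g
keep M g    ∘ₙ keep .M f    = keep M (g ∘ₙ f)
erase g     ∘ₙ keep .□ f    = erase (g ∘ₙ f)
join M g    ∘ₙ keep .◇ f    = join M (g ∘ₙ f)
joinErase g ∘ₙ keep .◇ f    = joinErase (g ∘ₙ f)
g           ∘ₙ erase f      = erase (g ∘ₙ f)
keep M g    ∘ₙ join .M f    = join M (keep M g ∘ₙ f)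
erase g     ∘ₙ join .□ f    = joinErase (keep □ g ∘ₙ f)
join M g    ∘ₙ join .◇ f    = join M (join M g ∘ₙ f)
joinErase g ∘ₙ join .◇ f    = joinErase (join □ g ∘ₙ f)
g           ∘ₙ joinErase f  = joinErase (keep □ g ∘ₙ f)

⌜∘ₙ⌝ : ∀ {A B C} (g : NF B C) (f : NF A B) → ⌜ g ∘ₙ f ⌝ ≈ ⌜ g ⌝ ∘ ⌜ f ⌝
⌜∘ₙ⌝ g nil = ≈-sym (idʳ ⌜ g ⌝)
⌜∘ₙ⌝ (keep M g) (keep .M f) = pre-cong M (⌜∘ₙ⌝ g f) ▸ pre-∘ M ⌜ g ⌝ ⌜ f ⌝
⌜∘ₙ⌝ (erase {B} g) (keep {A} .□ f) =
  ∘-congʳ (⌜∘ₙ⌝ g f) ▸ assoc⁻ ⌜ g ⌝ ⌜ f ⌝ (ε□ A)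
  ▸ ∘-congˡ (≈-sym (ε□-nat ⌜ f ⌝)) ▸ assoc ⌜ g ⌝ (ε□ B) (pre □ ⌜ f ⌝)
⌜∘ₙ⌝ (join M g) (keep .◇ f) = merge-cong M (⌜∘ₙ⌝ g f) ▸ merge-∘ M ⌜ g ⌝ ⌜ f ⌝
⌜∘ₙ⌝ (joinErase {B = C} g) (keep .◇ f) =
  ∘-congˡ (merge-cong □ (⌜∘ₙ⌝ g f) ▸ merge-∘ □ ⌜ g ⌝ ⌜ f ⌝)
  ▸ assoc (ε□ C) (merge □ ⌜ g ⌝) (pre ◇ ⌜ f ⌝)
⌜∘ₙ⌝ g (erase {A} f) = ∘-congʳ (⌜∘ₙ⌝ g f) ▸ assoc⁻ ⌜ g ⌝ ⌜ f ⌝ (ε□ A)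
⌜∘ₙ⌝ (keep M g) (join .M f) = merge-cong M (⌜∘ₙ⌝ (keep M g) f) ▸ merge-pre M ⌜ g ⌝ ⌜ f ⌝
⌜∘ₙ⌝ (erase g) (join .□ f) = ∘-congˡ (merge-cong □ (⌜∘ₙ⌝ (keep □ g) f)) ▸ ε□-merge-pre ⌜ g ⌝ ⌜ f ⌝
⌜∘ₙ⌝ (join M g) (join .◇ f) = merge-cong M (⌜∘ₙ⌝ (join M g) f) ▸ merge-merge M ⌜ g ⌝ ⌜ f ⌝
⌜∘ₙ⌝ (joinErase {B = C} g) (join .◇ f) =
  ∘-congˡ (merge-cong □ (⌜∘ₙ⌝ (join □ g) f) ▸ merge-merge □ ⌜ g ⌝ ⌜ f ⌝)
  ▸ assoc (ε□ C) (merge □ ⌜ g ⌝) (merge ◇ ⌜ f ⌝)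
⌜∘ₙ⌝ g (joinErase {B = B} f) =
  ∘-congˡ (merge-cong □ (⌜∘ₙ⌝ (keep □ g) f)) ▸ ε□-merge-pre ⌜ g ⌝ ⌜ f ⌝
  ▸ assoc⁻ ⌜ g ⌝ (ε□ B) (merge □ ⌜ f ⌝)

idₙ : ∀ A → NF A A
idₙ []      = nil
idₙ (M ∷ A) = keep M (idₙ A)

⌜idₙ⌝ : ∀ A → ⌜ idₙ A ⌝ ≈ 𝟏 A
⌜idₙ⌝ []      = ≈-refl
⌜idₙ⌝ (M ∷ A) = pre-cong M (⌜idₙ⌝ A) ▸ pre-id M A

nf : ∀ {A B} → A ⊢ B → NF A B
nf (𝟏 A)     = idₙ A
nf (ε□ A)    = erase (idₙ A)
nf (δ M A)   = join M (keep M (idₙ A))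
nf (g ∘ f)   = nf g ∘ₙ nf f
nf (pre M f) = keep M (nf f)

≈⌜nf⌝ : ∀ {A B} (f : A ⊢ B) → f ≈ ⌜ nf f ⌝
≈⌜nf⌝ (𝟏 A)     = ≈-sym (⌜idₙ⌝ A)
≈⌜nf⌝ (ε□ A)    = ≈-sym (∘-congʳ (⌜idₙ⌝ A) ▸ idˡ (ε□ A))
≈⌜nf⌝ (δ M A)   = ≈-sym (merge-cong M (⌜idₙ⌝ (M ∷ A)) ▸ ∘-congˡ (pre-id ◇ (M ∷ A)) ▸ idʳ (δ M A))
≈⌜nf⌝ (g ∘ f)   = ∘-cong (≈⌜nf⌝ g) (≈⌜nf⌝ f) ▸ ≈-sym (⌜∘ₙ⌝ (nf g) (nf f))
≈⌜nf⌝ (pre M f) = pre-cong M (≈⌜nf⌝ f)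

-- Canonical labellings of normal forms

detach : ℕ → ℕ → Label → Label
detach b a (inj₁ j) with j ≟ b
... | yes _ = inj₂ (leaf a)
... | no _  = inj₁ j
detach b a (inj₂ t) = inj₂ t

detach-≡ : ∀ b a → detach b a (inj₁ b) ≡ inj₂ (leaf a)
detach-≡ b a with b ≟ b
... | yes _  = refl
... | no b≢b = ⊥-elim (b≢b refl)

detach-≢ : ∀ {b j} a → j ≢ b → detach b a (inj₁ j) ≡ inj₁ j
detach-≢ {b} {j} a j≢b with j ≟ b
... | yes j≡b = ⊥-elim (j≢b j≡b)
... | no _    = refl

seal : ℕ → Labelling → Labelling
seal a = update a (inj₂ (leaf a))

-- A class without target is tagged leaf d, where d is its topmost source occurrence.
canon : ∀ {A B} → NF A B → Labelling
canon nil                   = inj₁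
canon (keep {A} {B} M n)    = extend (length A) (length B) (canon n)
canon (erase {A} n)         = seal (length A) (canon n)
canon (join {A} {B} M n)    = extend (length A) (length B) (canon n)
canon (joinErase {A} {B} n) = seal (length A) (λ i → detach (length B) (length A) (canon n i))

TopTagged : ℕ → Labelling → Set
TopTagged a φ = ∀ i t → i < a → φ i ≡ inj₂ t →
                ∃ λ d → t ≡ leaf d × d < a × i ≤ d × φ d ≡ inj₂ (leaf d)

Surjective : ℕ → ℕ → Labelling → Set
Surjective a b φ = ∀ j → j < b → ∃ λ i → i < a × φ i ≡ inj₁ j

record Canonical (a b : ℕ) (φ : Labelling) : Set where
  field
    bounded    : Bounded a b φ
    topTagged  : TopTagged a φ
    surjective : Surjective a b φ

open Canonical

TopTagged-update : ∀ {a v φ} → TopTagged a φ → (∀ t → v ≡ inj₂ t → t ≡ leaf a) → TopTagged (suc a) (update a v φ)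
TopTagged-update {a} {v} {φ} tφ tv i t i<1+a eq with update-cases i<1+a eq
... | inj₁ (refl , v≡t) = a , tv t v≡t , ≤-refl , ≤-refl , trans (update-≡ a v φ) (trans v≡t (cong inj₂ (tv t v≡t)))
... | inj₂ (i<a , φi) with tφ i t i<a φi
...   | d , t≡d , d<a , i≤d , φd = d , t≡d , m<n⇒m<1+n d<a , i≤d , trans (update-< v φ d<a) φd

Surjective-update : ∀ {a b v φ} → Surjective a b φ → Surjective (suc a) b (update a v φ)
Surjective-update {v = v} {φ} sφ j j<b with sφ j j<b
... | i , i<a , φi = i , m<n⇒m<1+n i<a , trans (update-< v φ i<a) φi

Canonical-extend : ∀ {a b c} → Canonical a b c → Canonical (suc a) (suc b) (extend a b c)
Canonical-extend {a} {b} {c} cc = record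
  { bounded    = Bounded-extend (bounded cc)
  ; topTagged  = TopTagged-update (topTagged cc) (λ _ eq → ⊥-elim (inj₁≢inj₂ eq))
  ; surjective = surjective-extend
  }
  where
  surjective-extend : Surjective (suc a) (suc b) (extend a b c)
  surjective-extend j j<1+b with m<1+n⇒m<n∨m≡n j<1+b
  ... | inj₁ j<b  = Surjective-update (surjective cc) j j<b
  ... | inj₂ refl = a , ≤-refl , update-≡ a _ c

Canonical-merge : ∀ {a b c} → Canonical a (suc b) c → Canonical (suc a) (suc b) (extend a b c)
Canonical-merge cc = record
  { bounded    = Bounded-update (bounded cc) (λ _ eq → ≤-reflexive (cong suc (sym (inj₁-injective eq))))
  ; topTagged  = TopTagged-update (topTagged cc) (λ _ eq → ⊥-elim (inj₁≢inj₂ eq))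
  ; surjective = Surjective-update (surjective cc)
  }

Canonical-seal : ∀ {a b c} → Canonical a b c → Canonical (suc a) b (seal a c)
Canonical-seal cc = record
  { bounded    = Bounded-update (bounded cc) (λ _ ())
  ; topTagged  = TopTagged-update (topTagged cc) (λ _ → inj₂-injective ∘′ sym)
  ; surjective = Surjective-update (surjective cc)
  }

module _ {a b : ℕ} {c : Labelling} (cc : Canonical a (suc b) c) where

  private
    ψ : Labelling
    ψ i = detach b a (c i)

  Bounded-detach : Bounded a b ψ
  Bounded-detach i j i<a eq with c i in ci
  ... | inj₁ k with k ≟ b | eq
  ...   | no k≢b | refl = ≤∧≢⇒< (≤-pred (bounded cc i k i<a ci)) k≢b

  Surjective-detach : Surjective a b ψ
  Surjective-detach j j<b with surjective cc j (m<n⇒m<1+n j<b)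
  ... | i , i<a , ci = i , i<a , trans (cong (detach b a) ci) (detach-≢ a (<⇒≢ j<b))

  TopTagged-seal-detach : TopTagged (suc a) (seal a ψ)
  TopTagged-seal-detach i t i<1+a eq with update-cases i<1+a eq
  ... | inj₁ (refl , refl) = a , refl , ≤-refl , ≤-refl , update-≡ a _ ψ
  ... | inj₂ (i<a , ψi) with c i in ci
  ...   | inj₂ s with refl ← ψi | topTagged cc i s i<a ci
  ...     | d , refl , d<a , i≤d , cd =
              d , refl , m<n⇒m<1+n d<a , i≤d , trans (update-< _ ψ d<a) (cong (detach b a) cd)
  TopTagged-seal-detach i t i<1+a eq | inj₂ (i<a , ψi) | inj₁ k with k ≟ b | ψi
  ...   | yes _ | refl = a , refl , ≤-refl , <⇒≤ i<a , update-≡ a _ ψ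

  Canonical-seal-detach : Canonical (suc a) b (seal a ψ)
  Canonical-seal-detach = record
    { bounded    = Bounded-update Bounded-detach (λ _ ())
    ; topTagged  = TopTagged-seal-detach
    ; surjective = Surjective-update Surjective-detach
    }

canonical : ∀ {A B} (n : NF A B) → Canonical (length A) (length B) (canon n)
canonical nil           = record { bounded = λ _ _ () ; topTagged = λ _ _ () ; surjective = λ _ () }
canonical (keep M n)    = Canonical-extend (canonical n)
canonical (erase n)     = Canonical-seal (canonical n)
canonical (join M n)    = Canonical-merge (canonical n)
canonical (joinErase n) = Canonical-seal-detach (canonical n)

renameLeaf : ℕ → Tag → (Tag → Tag) → Tag → Tag
renameLeaf a s e (leaf d) with d ≟ a
... | yes _ = s
... | no _  = e (leaf d)
renameLeaf a s e t = e t

renameLeaf-≡ : ∀ a s e → renameLeaf a s e (leaf a) ≡ s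
renameLeaf-≡ a s e with a ≟ a
... | yes _  = refl
... | no a≢a = ⊥-elim (a≢a refl)

renameLeaf-≢ : ∀ {a d} s e → d ≢ a → renameLeaf a s e (leaf d) ≡ e (leaf d)
renameLeaf-≢ {a} {d} s e d≢a with d ≟ a
... | yes d≡a = ⊥-elim (d≢a d≡a)
... | no _    = refl

rename-canonical-≗ : ∀ {a b φ} (e e′ : Tag → Tag) → Canonical a b φ →
                     (∀ {d} → d < a → e (leaf d) ≡ e′ (leaf d)) →
                     ∀ i → i < a → map₂ e (φ i) ≡ map₂ e′ (φ i)
rename-canonical-≗ {φ = φ} e e′ cφ e≗e′ i i<a with φ i in φi
... | inj₁ _ = refl
... | inj₂ t with topTagged cφ i t i<a φi
...   | d , refl , d<a , _ = cong inj₂ (e≗e′ d<a)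

G-merge : ∀ {A B} (M : Mod) (f : A ⊢ (M ∷ B)) {φ} → G f ≐ Ker (length A) (suc (length B)) φ →
          Bounded (length A) (suc (length B)) φ →
          G (merge M f) ≐ Ker (suc (length A)) (suc (length B)) (δL (length B) ⊙ extend (length A) (suc (length B)) φ)
G-merge {A} {B} M f {φ} Gf≐φ bφ =
  ≐-trans (∘G-cong (≐-trans (preG-cong Gf≐φ) (Ker-preG φ bφ)) (G-δ M B))
          (Ker-∘G (extend (length A) (suc (length B)) φ) (δL (length B)) (Bounded-extend bφ))

erasing : ℕ → Tag → Tag
erasing a = renameLeaf a (earlier (leaf 0)) later

erasing⁻ : ℕ → Tag → Tag
erasing⁻ a (leaf d)    = leaf d
erasing⁻ a (earlier _) = leaf a
erasing⁻ a (later t)   = t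

erasing⁻-erasing : ∀ a t → erasing⁻ a (erasing a t) ≡ t
erasing⁻-erasing a (leaf d) with d ≟ a
... | yes d≡a = cong leaf (sym d≡a)
... | no _    = refl
erasing⁻-erasing a (earlier _) = refl
erasing⁻-erasing a (later _)   = refl

mergeErasing : ℕ → Tag → Tag
mergeErasing a = renameLeaf a (later (leaf 0)) (λ t → earlier (earlier t))

mergeErasing⁻ : ℕ → Tag → Tag
mergeErasing⁻ a (leaf d)    = leaf d
mergeErasing⁻ a (earlier t) = strip t
mergeErasing⁻ a (later _)   = leaf a

mergeErasing⁻-mergeErasing : ∀ a t → mergeErasing⁻ a (mergeErasing a t) ≡ t
mergeErasing⁻-mergeErasing a (leaf d) with d ≟ a
... | yes d≡a = cong leaf (sym d≡a)
... | no _    = refl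
mergeErasing⁻-mergeErasing a (earlier _) = refl
mergeErasing⁻-mergeErasing a (later _)   = refl

⊙εL-seal : ∀ {a b c} → Canonical a b c → c ⊙ εL a ≗[ suc a ] rename (erasing a) (seal a c)
⊙εL-seal {a} {c = c} cc = ≗-step below top
  where
  below : c ⊙ εL a ≗[ a ] rename (erasing a) (seal a c)
  below i i<a = begin
    push c (εL a i)                ≡⟨ cong (push c) (update-< _ inj₁ i<a) ⟩
    map₂ later (c i)
      ≡⟨ rename-canonical-≗ later (erasing a) cc (λ d<a → sym (renameLeaf-≢ _ later (<⇒≢ d<a))) i i<a ⟩
    map₂ (erasing a) (c i)         ≡⟨ cong (map₂ (erasing a)) (update-< _ c i<a) ⟨
    map₂ (erasing a) (seal a c i)  ∎
    where open ≡-Reasoning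
  top : (c ⊙ εL a) a ≡ rename (erasing a) (seal a c) a
  top rewrite update-≡ a (inj₂ (leaf 0)) inj₁ | update-≡ a (inj₂ (leaf a)) c
            | renameLeaf-≡ a (earlier (leaf 0)) later = refl

δL⊙extend : ∀ {a b c} → Bounded a (suc b) c → δL b ⊙ extend a (suc b) c ≗[ suc a ] rename earlier (extend a b c)
δL⊙extend {a} {b} {c} bc = ≗-step below top
  where
  below : δL b ⊙ extend a (suc b) c ≗[ a ] rename earlier (extend a b c)
  below i i<a = begin
    push (δL b) (extend a (suc b) c i) ≡⟨ cong (push (δL b)) (extend-≗ a (suc b) c i i<a) ⟩
    push (δL b) (c i)                  ≡⟨ push-≗inj₁ (δL-≗ b) (c i) (λ j → bc i j i<a) ⟩
    map₂ earlier (c i)                 ≡⟨ cong (map₂ earlier) (extend-≗ a b c i i<a) ⟨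
    map₂ earlier (extend a b c i)      ∎
    where open ≡-Reasoning
  top : (δL b ⊙ extend a (suc b) c) a ≡ rename earlier (extend a b c) a
  top rewrite update-≡ a (inj₁ (suc b)) c | update-≡ a (inj₁ b) c | suc-⊓ b = refl

module _ {a b : ℕ} {c : Labelling} (cc : Canonical a (suc b) c) where

  private
    ψ : Labelling
    ψ i = detach b a (c i)

  εL⊙δL-detach : ∀ i → i < a → push (εL b) (push (δL b) (c i)) ≡ map₂ (mergeErasing a) (ψ i)
  εL⊙δL-detach i i<a with c i in ci
  ... | inj₂ t with topTagged cc i t i<a ci
  ...   | d , refl , d<a , _ = cong inj₂ (sym (renameLeaf-≢ _ _ (<⇒≢ d<a)))
  εL⊙δL-detach i i<a | inj₁ j with m<1+n⇒m<n∨m≡n (bounded cc i j i<a ci)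
  ...   | inj₁ j<b  rewrite m≤n⇒m⊓n≡m (<⇒≤ j<b) | update-< (inj₂ (leaf 0)) inj₁ j<b | detach-≢ a (<⇒≢ j<b) = refl
  ...   | inj₂ refl rewrite ⊓-idem b | update-≡ b (inj₂ (leaf 0)) inj₁ | detach-≡ b a
                          | renameLeaf-≡ a (later (leaf 0)) (λ t → earlier (earlier t)) = refl

  εL⊙δL⊙extend : εL b ⊙ δL b ⊙ extend a (suc b) c ≗[ suc a ] rename (mergeErasing a) (seal a ψ)
  εL⊙δL⊙extend = ≗-step below top
    where
    below : εL b ⊙ δL b ⊙ extend a (suc b) c ≗[ a ] rename (mergeErasing a) (seal a ψ)
    below i i<a = begin
      push (εL b) (push (δL b) (extend a (suc b) c i)) ≡⟨ cong (push (εL b) ∘′ push (δL b)) (extend-≗ a (suc b) c i i<a) ⟩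
      push (εL b) (push (δL b) (c i))                  ≡⟨ εL⊙δL-detach i i<a ⟩
      map₂ (mergeErasing a) (ψ i)                      ≡⟨ cong (map₂ (mergeErasing a)) (update-< _ ψ i<a) ⟨
      map₂ (mergeErasing a) (seal a ψ i)               ∎
      where open ≡-Reasoning
    top : (εL b ⊙ δL b ⊙ extend a (suc b) c) a ≡ rename (mergeErasing a) (seal a ψ) a
    top rewrite update-≡ a (inj₁ (suc b)) c | suc-⊓ b | update-≡ b (inj₂ (leaf 0)) inj₁
              | update-≡ a (inj₂ (leaf a)) ψ | renameLeaf-≡ a (later (leaf 0)) (λ t → earlier (earlier t)) = refl

G⌜⌝ : ∀ {A B} (n : NF A B) → G ⌜ n ⌝ ≐ Ker (length A) (length B) (canon n)
G⌜⌝ nil        = G-𝟏 []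
G⌜⌝ (keep M n) = ≐-trans (preG-cong (G⌜⌝ n)) (Ker-preG (canon n) (bounded (canonical n)))
G⌜⌝ (erase {A} n) =
  ≐-trans (∘G-cong (G-ε□ A) (G⌜⌝ n))
  (≐-trans (Ker-∘G (εL a) (canon n) (Bounded-⟦⟧ (ε□ A)))
           (≐-sym (Ker-rename (erasing a) (erasing⁻ a) (erasing⁻-erasing a) (⊙εL-seal (canonical n)))))
  where a = length A
G⌜⌝ (join M n) =
  ≐-trans (G-merge M ⌜ n ⌝ (G⌜⌝ n) (bounded (canonical n)))
          (≐-sym (Ker-rename earlier strip (λ _ → refl) (δL⊙extend (bounded (canonical n)))))
G⌜⌝ (joinErase {A} {B} n) =
  ≐-trans (∘G-cong (G-merge □ ⌜ n ⌝ (G⌜⌝ n) (bounded IH)) (G-ε□ B))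
  (≐-trans (Ker-∘G _ (εL (length B)) (Bounded-⊙ (Bounded-extend (bounded IH)) (Bounded-⟦⟧ (δ □ B))))
           (≐-sym (Ker-rename (mergeErasing a) (mergeErasing⁻ a) (mergeErasing⁻-mergeErasing a) (εL⊙δL⊙extend IH))))
  where
  IH = canonical n
  a = length A

label-fromℕ< : ∀ {n m} (φ : Labelling) {i} (i<n : i < n) → label {n} {m} φ (inj₁ (fromℕ< i<n)) ≡ φ i
label-fromℕ< φ i<n = cong φ (toℕ-fromℕ< i<n)

Ker-source : ∀ {n m φ ψ} → Ker n m φ ≐ Ker n m ψ → ∀ {i i′} → i < n → i′ < n → φ i ≡ φ i′ → ψ i ≡ ψ i′
Ker-source {m = m} {φ} {ψ} φ≐ψ i<n i′<n eq =
  trans (sym (label-fromℕ< {m = m} ψ i<n))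
        (trans (proj₁ (φ≐ψ (inj₁ (fromℕ< i<n)) (inj₁ (fromℕ< i′<n)))
                      (trans (label-fromℕ< {m = m} φ i<n) (trans eq (sym (label-fromℕ< {m = m} φ i′<n)))))
               (label-fromℕ< {m = m} ψ i′<n))

Ker-target : ∀ {n m φ ψ} → Ker n m φ ≐ Ker n m ψ → ∀ {i j} → i < n → j < m → φ i ≡ inj₁ j → ψ i ≡ inj₁ j
Ker-target {m = m} {φ} {ψ} φ≐ψ i<n j<m eq =
  trans (sym (label-fromℕ< {m = m} ψ i<n))
        (trans (proj₁ (φ≐ψ (inj₁ (fromℕ< i<n)) (inj₂ (fromℕ< j<m)))
                      (trans (label-fromℕ< {m = m} φ i<n) (trans eq (cong inj₁ (sym (toℕ-fromℕ< j<m))))))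
               (cong inj₁ (toℕ-fromℕ< j<m)))

tag-above : ∀ {a b φ} → Canonical a b φ → ∀ {d e} → d < a → φ d ≡ inj₂ (leaf e) → d ≤ e
tag-above cφ d<a φd with topTagged cφ _ _ d<a φd
... | _ , refl , _ , d≤e , _ = d≤e

Canonical-unique : ∀ {a b φ ψ} → Canonical a b φ → Canonical a b ψ → Ker a b φ ≐ Ker a b ψ → φ ≗[ a ] ψ
Canonical-unique {φ = φ} {ψ} cφ cψ φ≐ψ i i<a with φ i in φi | ψ i in ψi
... | inj₁ j | _ = trans (sym (Ker-target φ≐ψ i<a (bounded cφ i j i<a φi) φi)) ψi
... | inj₂ _ | inj₁ j = ⊥-elim (inj₁≢inj₂ (trans (sym (Ker-target (≐-sym φ≐ψ) i<a (bounded cψ i j i<a ψi) ψi)) φi))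
... | inj₂ t | inj₂ t′ with topTagged cφ i t i<a φi | topTagged cψ i t′ i<a ψi
...   | d , refl , d<a , _ , φd | d′ , refl , d′<a , _ , ψd′ =
  cong (inj₂ ∘′ leaf) (≤-antisym (tag-above cψ d<a ψd≡d′) (tag-above cφ d′<a φd′≡d))
  where
  ψd≡d′ : ψ d ≡ inj₂ (leaf d′)
  ψd≡d′ = trans (sym (Ker-source φ≐ψ i<a d<a (trans φi (sym φd)))) ψi
  φd′≡d : φ d′ ≡ inj₂ (leaf d)
  φd′≡d = trans (sym (Ker-source (≐-sym φ≐ψ) i<a d′<a (trans ψi (sym ψd′)))) φi

detach-injective : ∀ b a {u v} → u ≢ inj₂ (leaf a) → v ≢ inj₂ (leaf a) → detach b a u ≡ detach b a v → u ≡ v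
detach-injective b a {inj₁ j} {inj₁ k} _ _ eq with j ≟ b | k ≟ b
... | yes j≡b | yes k≡b = cong inj₁ (trans j≡b (sym k≡b))
... | no _    | no _    = eq
detach-injective b a {inj₁ j} {inj₂ t} _ v≢a eq with j ≟ b
... | yes _ = ⊥-elim (v≢a (sym eq))
detach-injective b a {inj₂ t} {inj₁ k} u≢a _ eq with k ≟ b
... | yes _ = ⊥-elim (u≢a eq)
detach-injective b a {inj₂ s} {inj₂ t} _ _ eq = eq

not-top-tag : ∀ {a b φ} → Canonical a b φ → ∀ {i} → i < a → φ i ≢ inj₂ (leaf a)
not-top-tag cφ i<a φi with topTagged cφ _ _ i<a φi
... | _ , refl , a<a , _ = <-irrefl refl a<a

-- A normal form onto M ∷ B reaches the target occurrence b, one onto B cannot.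
surjective-clash : ∀ {A B} (M : Mod) (n₁ : NF A B) (n₂ : NF A (M ∷ B)) → ¬ (canon n₁ ≗[ length A ] canon n₂)
surjective-clash {B = B} M n₁ n₂ eq with surjective (canonical n₂) (length B) ≤-refl
... | i , i<a , c₂i = <-irrefl refl (bounded (canonical n₁) i (length B) i<a (trans (eq i i<a) c₂i))

canon-injective : ∀ {A B} (n₁ n₂ : NF A B) → canon n₁ ≗[ length A ] canon n₂ → n₁ ≡ n₂
canon-injective nil nil _ = refl
canon-injective (keep M n₁) (keep .M n₂) eq = cong (keep M) (canon-injective n₁ n₂ (update-below eq))
canon-injective (erase n₁) (erase n₂) eq = cong erase (canon-injective n₁ n₂ (update-below eq))
canon-injective (join M n₁) (join .M n₂) eq = cong (join M) (canon-injective n₁ n₂ (update-below eq))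
canon-injective (joinErase {B = B} n₁) (joinErase n₂) eq =
  cong joinErase (canon-injective n₁ n₂ λ i i<a →
    detach-injective (length B) _ (not-top-tag (canonical n₁) i<a) (not-top-tag (canonical n₂) i<a)
                     (update-below eq i i<a))
canon-injective (keep .◇ n₁) (join .◇ n₂) eq = ⊥-elim (surjective-clash ◇ n₁ n₂ (update-below eq))
canon-injective (join .◇ n₁) (keep .◇ n₂) eq =
  ⊥-elim (surjective-clash ◇ n₂ n₁ (λ i i<a → sym (update-below eq i i<a)))
canon-injective (keep .□ _) (erase _)     eq = ⊥-elim (inj₁≢inj₂ (update-top eq))
canon-injective (keep .◇ _) (joinErase _) eq = ⊥-elim (inj₁≢inj₂ (update-top eq))
canon-injective (join _ _)  (joinErase _) eq = ⊥-elim (inj₁≢inj₂ (update-top eq))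
canon-injective (erase _)     (keep .□ _) eq = ⊥-elim (inj₁≢inj₂ (sym (update-top eq)))
canon-injective (joinErase _) (keep .◇ _) eq = ⊥-elim (inj₁≢inj₂ (sym (update-top eq)))
canon-injective (joinErase _) (join _ _)  eq = ⊥-elim (inj₁≢inj₂ (sym (update-top eq)))

mainTheorem5 : ∀ {A B : Modality} (f g : A ⊢ B) → G f ≐ G g → f ≈ g
mainTheorem5 f g Gf≐Gg = ≈⌜nf⌝ f ▸ subst (λ n → ⌜ nf f ⌝ ≈ ⌜ n ⌝) nf-f≡nf-g ≈-refl ▸ ≈-sym (≈⌜nf⌝ g)
  where
  kernels : Ker _ _ (canon (nf f)) ≐ Ker _ _ (canon (nf g))
  kernels = ≐-trans (≐-sym (G⌜⌝ (nf f))) (≐-trans (G-resp-≈ (≈-sym (≈⌜nf⌝ f)))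
              (≐-trans Gf≐Gg (≐-trans (G-resp-≈ (≈⌜nf⌝ g)) (G⌜⌝ (nf g)))))
  nf-f≡nf-g : nf f ≡ nf g
  nf-f≡nf-g = canon-injective (nf f) (nf g) (Canonical-unique (canonical (nf f)) (canonical (nf g)) kernels)
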